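{- Let $n \geq 5$ and $k \geq 2$ be integers with $2k<n$ and $\gcd(n,k)=1$. Then $$5 \leq \sigma^{ - }(P(n,k)) \leq n.$$
   Context: For $n \geq 3$, $k \geq 1$ with $2k<n$, the generalized Petersen graph $P(n,k)$ has vertex set $\{u_i, v_i : i=0,1,\dots,n-1\}$ and edge set $\{u_iu_{i+1},\ u_iv_i,\ v_iv_{i+k} : i=0,\dots,n-1\}$, subscripts read modulo $n$. For a simple connected graph $G$ of order $N$, the \textbf{rna} number $\sigma^{ - }(G)$ is the minimum, over all bijections $f: V(G)\to\{1,2,\dots,N\}$, of the number of edges $uv$ of $G$ such that $f(u)$ and $f(v)$ have different parity. -}

module Defs where

open import Data.Nat using (ℕ; zero; suc; _+_; _*_; _%_)
open import Data.Nat.DivMod using (_mod_)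
open import Data.Fin using (Fin; toℕ)
open import Data.Sum using (_⊎_; inj₁; inj₂)
open import Data.Product using (_×_; _,_)
open import Data.List using (List; []; _∷_; _++_; concatMap; upTo)
open import Data.Bool using (if_then_else_)
open import Relation.Nullary using (does)
open import Relation.Binary.PropositionalEquality using (_≡_)
open import Function.Definitions using (Bijective)
import Data.Nat as ℕ

-- Vertex set of P(n,k): inj₁ i = u_i, inj₂ i = v_i  (i ∈ {0,…,n-1})
PVertex : ℕ → Set
PVertex n = Fin n ⊎ Fin n

-- For n ≥ 3, 1 ≤ k, 2k < n these 3n edges are pairwise
-- distinct, so this lists every edge of the simple graph exactly once.
PEdges : (n k : ℕ) → List (PVertex n × PVertex n)
PEdges zero    k = []
PEdges (suc m) k = concatMap edgesAt (upTo (suc m))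
  where
  N = suc m
  edgesAt : ℕ → List (PVertex N × PVertex N)
  edgesAt i = (inj₁ (i mod N) , inj₁ ((i + 1) mod N))
            ∷ (inj₁ (i mod N) , inj₂ (i mod N))
            ∷ (inj₂ (i mod N) , inj₂ ((i + k) mod N))
            ∷ []

label : ∀ {V : Set} {N : ℕ} → (V → Fin N) → V → ℕ
label f x = suc (toℕ (f x))

oddEdges : ∀ {V : Set} {N : ℕ} → (V → Fin N) → List (V × V) → ℕ
oddEdges f [] = 0
oddEdges f ((x , y) ∷ es) =
  if does (label f x % 2 ℕ.≟ label f y % 2)
  then oddEdges f es
  else suc (oddEdges f es)

IsLabelling : (n : ℕ) → (PVertex n → Fin (2 * n)) → Set
IsLabelling n f = Bijective _≡_ _≡_ f

-- Write α t and β t for the parities of the labels of u_t and v_t. The odd edges of a labelling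
-- number A + R + B, where A and B count the parity changes along the outer cycle and along the
-- inner cycle t ↦ t + k (a single n-cycle, as gcd(n,k) = 1), and R the spokes with α t ≠ β t.
-- A and B are even. If A = 0 or B = 0 that cycle is monochromatic, and since exactly n of the
-- labels 1,…,2n are odd, every spoke is odd: R = n ≥ 5. Otherwise A, B ≥ 2, so the bound can only
-- fail when R = 0 and A = B = 2. Then α = β takes the value 1 exactly n/2 times, the outer cycle
-- consists of two runs of length n/2 > k, every window of k consecutive steps meets at most one
-- change, and hence B = 2k ≥ 4.
-- For the upper bound give u_i the odd label 2i+1 and v_i the even label 2i+2: only spokes are odd.

module Submission where

open import Defs
open import Data.Nat
open import Data.Nat.Properties
open import Data.Nat.DivMod
open import Data.Nat.GCD using (gcd; gcd-GCD; gcd[m,n]∣n; module Bézout)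
open import Data.Nat.Divisibility using (∣1⇒≡1)
open import Data.Empty using (⊥; ⊥-elim)
open import Data.Fin.Base using (Fin; toℕ; fromℕ<)
open import Data.Fin.Properties using (toℕ-injective; toℕ-fromℕ<; toℕ<n)
open import Function.Bundles using (_↔_; mk↔ₛ′; mk⤖; module Bijection)
open import Function.Properties.Inverse using (↔-sym; ↔-trans; ↔⇒⤖)
open import Function.Properties.Bijection using (⤖⇒↔)
open import Data.Fin.Permutation using (Permutation)
open import Data.List.Base using (List; []; _∷_; _++_; concatMap; applyUpTo)
open import Algebra.Properties.CommutativeMonoid.Sum +-0-commutativeMonoid using (sum; sum-permute)
open import Algebra.Properties.CommutativeSemigroup +-commutativeSemigroup using (interchange)
open import Data.Bool.Base using (if_then_else_; true; false; T)
open import Data.Unit.Base using (tt)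
open import Function.Base using (_∘_)
open import Data.Product.Base using (Σ; _×_; _,_)
open import Data.Sum.Base using (inj₁; inj₂)
open import Relation.Nullary using (yes; no)
open import Relation.Nullary.Negation using (contradiction)
open import Relation.Binary.PropositionalEquality

∑< : ℕ → (ℕ → ℕ) → ℕ
∑< zero    g = 0
∑< (suc n) g = g 0 + ∑< n (g ∘ suc)

syntax ∑< n (λ t → e) = ∑[ t < n ] e

∑-cong : ∀ n {g h} → (∀ t → t < n → g t ≡ h t) → ∑< n g ≡ ∑< n h
∑-cong zero    eq = refl
∑-cong (suc n) eq = cong₂ _+_ (eq 0 z<s) (∑-cong n (λ t t<n → eq (suc t) (s<s t<n)))

∑-distrib-+ : ∀ n g h → ∑[ t < n ] (g t + h t) ≡ ∑< n g + ∑< n h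
∑-distrib-+ zero    g h = refl
∑-distrib-+ (suc n) g h = trans (cong (g 0 + h 0 +_) (∑-distrib-+ n (g ∘ suc) (h ∘ suc)))
                                (interchange (g 0) (h 0) (∑< n (g ∘ suc)) (∑< n (h ∘ suc)))

∑-distribˡ-* : ∀ n c g → ∑[ t < n ] (c * g t) ≡ c * ∑< n g
∑-distribˡ-* zero    c g = sym (*-zeroʳ c)
∑-distribˡ-* (suc n) c g =
  trans (cong (c * g 0 +_) (∑-distribˡ-* n c (g ∘ suc))) (sym (*-distribˡ-+ c (g 0) _))

∑-const : ∀ n c → ∑[ t < n ] c ≡ n * c
∑-const zero    c = refl
∑-const (suc n) c = cong (c +_) (∑-const n c)

∑-split : ∀ m n g → ∑< (m + n) g ≡ ∑< m g + ∑[ t < n ] g (m + t)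
∑-split zero    n g = refl
∑-split (suc m) n g = trans (cong (g 0 +_) (∑-split m n (g ∘ suc))) (sym (+-assoc (g 0) _ _))

∑-last : ∀ n g → ∑< (suc n) g ≡ ∑< n g + g n
∑-last n g = begin
  ∑< (suc n) g                ≡⟨ cong (λ m → ∑< m g) (+-comm 1 n) ⟩
  ∑< (n + 1) g                ≡⟨ ∑-split n 1 g ⟩
  ∑< n g + (g (n + 0) + 0)    ≡⟨ cong (∑< n g +_) (trans (+-identityʳ _) (cong g (+-identityʳ n))) ⟩
  ∑< n g + g n                ∎
  where open ≡-Reasoning

∑-rotate : ∀ n g → (∀ t → g (t + n) ≡ g t) → ∀ s → ∑[ t < n ] g (s + t) ≡ ∑< n g
∑-rotate n g period zero    = refl
∑-rotate n g period (suc s) = begin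
  ∑[ t < n ] g (suc s + t)    ≡⟨ ∑-cong n (λ t _ → cong g (sym (+-suc s t))) ⟩
  ∑[ t < n ] g (s + suc t)    ≡⟨ rotate₁ (λ t → g (s + t)) (trans (period s) (cong g (sym (+-identityʳ s)))) ⟩
  ∑[ t < n ] g (s + t)        ≡⟨ ∑-rotate n g period s ⟩
  ∑< n g                      ∎
  where
  open ≡-Reasoning
  rotate₁ : ∀ h → h n ≡ h 0 → ∑< n (h ∘ suc) ≡ ∑< n h
  rotate₁ h hn≡h0 = +-cancelʳ-≡ (h 0) _ _ (begin
    ∑< n (h ∘ suc) + h 0   ≡⟨ +-comm _ (h 0) ⟩
    ∑< (suc n) h           ≡⟨ ∑-last n h ⟩
    ∑< n h + h n           ≡⟨ cong (∑< n h +_) hn≡h0 ⟩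
    ∑< n h + h 0           ∎)

∑≡0⇒≡0 : ∀ n g → ∑< n g ≡ 0 → ∀ t → t < n → g t ≡ 0
∑≡0⇒≡0 (suc n) g sum≡0 zero    _         = m+n≡0⇒m≡0 (g 0) sum≡0
∑≡0⇒≡0 (suc n) g sum≡0 (suc t) (s<s t<n) = ∑≡0⇒≡0 n (g ∘ suc) (m+n≡0⇒n≡0 (g 0) sum≡0) t t<n

∑-mono-≤ : ∀ n {g h} → (∀ t → g t ≤ h t) → ∑< n g ≤ ∑< n h
∑-mono-≤ zero    g≤h = z≤n
∑-mono-≤ (suc n) g≤h = +-mono-≤ (g≤h 0) (∑-mono-≤ n (g≤h ∘ suc))

∑-comm : ∀ m n (F : ℕ → ℕ → ℕ) → ∑[ i < m ] ∑[ t < n ] F i t ≡ ∑[ t < n ] ∑[ i < m ] F i t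
∑-comm m zero    F = trans (∑-const m 0) (*-zeroʳ m)
∑-comm m (suc n) F = trans (∑-distrib-+ m (λ i → F i 0) (λ i → ∑[ t < n ] F i (suc t)))
                           (cong (∑[ i < m ] F i 0 +_) (∑-comm m n (λ i t → F i (suc t))))

∑-pairs : ∀ n g → ∑< (2 * n) g ≡ ∑[ i < n ] (g (2 * i) + g (suc (2 * i)))
∑-pairs zero    g = refl
∑-pairs (suc n) g = begin
  ∑< (2 * suc n) g                                        ≡⟨ cong (λ m → ∑< m g) (*-suc 2 n) ⟩
  g 0 + (g 1 + ∑< (2 * n) (g ∘ suc ∘ suc))                ≡⟨ +-assoc (g 0) (g 1) _ ⟨
  g 0 + g 1 + ∑< (2 * n) (g ∘ suc ∘ suc)                  ≡⟨ cong (g 0 + g 1 +_) (∑-pairs n (g ∘ suc ∘ suc)) ⟩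
  g 0 + g 1 + ∑[ i < n ] (g (2 + 2 * i) + g (3 + 2 * i))  ≡⟨ cong (g 0 + g 1 +_) (∑-cong n (λ i _ → cong (λ j → g j + g (suc j)) (sym (*-suc 2 i)))) ⟩
  g 0 + g 1 + ∑[ i < n ] (g (2 * suc i) + g (suc (2 * suc i))) ∎
  where open ≡-Reasoning

differ : ℕ → ℕ → ℕ
differ x y = if x ≡ᵇ y then 0 else 1

differ≡0⇒≡ : ∀ x y → differ x y ≡ 0 → x ≡ y
differ≡0⇒≡ x y eq with x ≡ᵇ y in x≡ᵇy
differ≡0⇒≡ x y eq | true = ≡ᵇ⇒≡ x y (subst T (sym x≡ᵇy) tt)

differ-refl : ∀ x → differ x x ≡ 0
differ-refl zero    = refl
differ-refl (suc x) = differ-refl x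

differ-comm : ∀ x y → differ x y ≡ differ y x
differ-comm zero    zero    = refl
differ-comm zero    (suc y) = refl
differ-comm (suc x) zero    = refl
differ-comm (suc x) (suc y) = differ-comm x y

differ+2*≡+ : ∀ {x y} → x ≤ 1 → y ≤ 1 → differ x y + 2 * (x * y) ≡ x + y
differ+2*≡+ z≤n       z≤n       = refl
differ+2*≡+ z≤n       (s≤s z≤n) = refl
differ+2*≡+ (s≤s z≤n) z≤n       = refl
differ+2*≡+ (s≤s z≤n) (s≤s z≤n) = refl

differ-trans : ∀ {x y z} → x ≤ 1 → y ≤ 1 → z ≤ 1 →
               differ x y + differ y z ≤ 1 → differ x z ≡ differ x y + differ y z
differ-trans z≤n       z≤n       z≤n       _             = refl
differ-trans z≤n       z≤n       (s≤s z≤n) _             = refl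
differ-trans z≤n       (s≤s z≤n) z≤n       (s≤s ())
differ-trans z≤n       (s≤s z≤n) (s≤s z≤n) _             = refl
differ-trans (s≤s z≤n) z≤n       z≤n       _             = refl
differ-trans (s≤s z≤n) z≤n       (s≤s z≤n) (s≤s ())
differ-trans (s≤s z≤n) (s≤s z≤n) z≤n       _             = refl
differ-trans (s≤s z≤n) (s≤s z≤n) (s≤s z≤n) _             = refl

m+n+1≡m+[1+n] : ∀ i t → i + t + 1 ≡ i + suc t
m+n+1≡m+[1+n] i t = trans (+-assoc i t 1) (cong (i +_) (+-comm t 1))

coprime⇒bézout : ∀ {m n} → gcd m n ≡ 1 → Bézout.Identity 1 m n
coprime⇒bézout {m} {n} coprime = subst (λ d → Bézout.Identity d m n) coprime (Bézout.identity (gcd-GCD m n))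

1+ab≡cd⇒t+tab≡tcd : ∀ t {a b c d} → 1 + a * b ≡ c * d → t + t * a * b ≡ t * c * d
1+ab≡cd⇒t+tab≡tcd t {a} {b} {c} {d} eq = begin
  t + t * a * b         ≡⟨ cong₂ _+_ (*-identityʳ t) (sym (*-assoc t a b)) ⟨
  t * 1 + t * (a * b)   ≡⟨ *-distribˡ-+ t 1 (a * b) ⟨
  t * (1 + a * b)       ≡⟨ cong (t *_) eq ⟩
  t * (c * d)           ≡⟨ *-assoc t c d ⟨
  t * c * d             ∎
  where open ≡-Reasoning

shift-invariant-iterate : ∀ {g : ℕ → ℕ} s → (∀ t → g (t + s) ≡ g t) → ∀ j t → g (t + j * s) ≡ g t
shift-invariant-iterate {g} s invariant zero    t = cong g (+-identityʳ t)
shift-invariant-iterate {g} s invariant (suc j) t =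
  trans (cong g (sym (+-assoc t s (j * s)))) (trans (shift-invariant-iterate s invariant j (t + s)) (invariant t))

n<[n∸k]+[n∸k] : ∀ k {n} → 2 * k < n → n < (n ∸ k) + (n ∸ k)
n<[n∸k]+[n∸k] k {n} 2k<n = begin-strict
  n                    ≡⟨ m+[n∸m]≡n k≤n ⟨
  k + (n ∸ k)          <⟨ +-monoˡ-< (n ∸ k) k<n∸k ⟩
  (n ∸ k) + (n ∸ k)    ∎
  where
  open ≤-Reasoning
  k≤n : k ≤ n
  k≤n = ≤-trans (m≤m+n k (k + 0)) (<⇒≤ 2k<n)
  k<n∸k : k < n ∸ k
  k<n∸k = +-cancelˡ-< k k (n ∸ k) (subst₂ _<_ (cong (k +_) (+-identityʳ k)) (sym (m+[n∸m]≡n k≤n)) 2k<n)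

five≤2a+[r+2b] : ∀ {n} a r b → 5 ≤ n → (a ≡ 0 → r ≡ n) → (b ≡ 0 → r ≡ n) →
                 (r ≡ 0 → a ≡ 1 → b ≡ 1 → ⊥) → 5 ≤ 2 * a + (r + 2 * b)
five≤2a+[r+2b] zero          r       b             5≤n a≡0⇒ _   _ =
  ≤-trans 5≤n (≤-trans (≤-reflexive (sym (a≡0⇒ refl))) (m≤m+n r (2 * b)))
five≤2a+[r+2b] (suc a)       r       zero          5≤n _   b≡0⇒ _ =
  ≤-trans 5≤n (≤-trans (≤-reflexive (sym (b≡0⇒ refl))) (≤-trans (m≤m+n r 0) (m≤n+m (r + 0) (2 * suc a))))
five≤2a+[r+2b] (suc a)       (suc r) (suc b)       _   _   _    _ =
  +-mono-≤ (*-monoʳ-≤ 2 (s≤s (z≤n {a}))) (+-mono-≤ (s≤s z≤n) (*-monoʳ-≤ 2 (s≤s (z≤n {b}))))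
five≤2a+[r+2b] (suc (suc a)) zero    (suc b)       _   _   _    _ =
  ≤-trans (n≤1+n 5) (+-mono-≤ (*-monoʳ-≤ 2 (s≤s (s≤s (z≤n {a})))) (*-monoʳ-≤ 2 (s≤s (z≤n {b}))))
five≤2a+[r+2b] (suc zero)    zero    (suc (suc b)) _   _   _    _ =
  ≤-trans (n≤1+n 5) (+-mono-≤ (≤-refl {2}) (*-monoʳ-≤ 2 (s≤s (s≤s (z≤n {b})))))
five≤2a+[r+2b] (suc zero)    zero    (suc zero)    _   _   _    excluded = ⊥-elim (excluded refl refl refl)

-- 0/1-colourings of the N-cycle, as functions on ℕ that are periodic modulo N

shift : ℕ → (ℕ → ℕ) → ℕ → ℕ
shift s g t = g (t + s)

module BinaryCyclic (N : ℕ) .{{_ : NonZero N}} where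

  Periodic : (ℕ → ℕ) → Set
  Periodic g = ∀ x y → x % N ≡ y % N → g x ≡ g y

  Binary : (ℕ → ℕ) → Set
  Binary g = ∀ t → g t ≤ 1

  mismatches : (ℕ → ℕ) → (ℕ → ℕ) → ℕ
  mismatches g h = ∑[ t < N ] differ (g t) (h t)

  module _ {g : ℕ → ℕ} (periodic : Periodic g) where

    periodic-+N : ∀ t → g (t + N) ≡ g t
    periodic-+N t = periodic (t + N) t ([m+n]%n≡m%n t N)

    periodic-% : ∀ t → g (t % N) ≡ g t
    periodic-% t = periodic (t % N) t (m%n%n≡m%n t N)

    shift-periodic : ∀ s → Periodic (shift s g)
    shift-periodic s x y x≡y = periodic (x + s) (y + s) (begin
      (x + s) % N                ≡⟨ %-distribˡ-+ x s N ⟩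
      (x % N + s % N) % N        ≡⟨ cong (λ r → (r + s % N) % N) x≡y ⟩
      (y % N + s % N) % N        ≡⟨ %-distribˡ-+ y s N ⟨
      (y + s) % N                ∎)
      where open ≡-Reasoning

    ∑-shift : ∀ s → ∑[ t < N ] g (t + s) ≡ ∑< N g
    ∑-shift s = trans (∑-cong N (λ t _ → cong g (+-comm t s))) (∑-rotate N g periodic-+N s)

  periodic-ext : ∀ {g h} → Periodic g → Periodic h → (∀ t → t < N → g t ≡ h t) → ∀ t → g t ≡ h t
  periodic-ext {g} {h} gp hp g≡h t = begin
    g t        ≡⟨ periodic-% gp t ⟨
    g (t % N)  ≡⟨ g≡h (t % N) (m%n<n t N) ⟩
    h (t % N)  ≡⟨ periodic-% hp t ⟩
    h t        ∎
    where open ≡-Reasoning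

  mismatches-comm : ∀ g h → mismatches g h ≡ mismatches h g
  mismatches-comm g h = ∑-cong N (λ t _ → differ-comm (g t) (h t))

  mismatches≡0⇒≡ : ∀ {g h} → Periodic g → Periodic h → mismatches g h ≡ 0 → ∀ t → g t ≡ h t
  mismatches≡0⇒≡ {g} {h} gp hp none = periodic-ext gp hp λ t t<N →
    differ≡0⇒≡ (g t) (h t) (∑≡0⇒≡0 N (λ t → differ (g t) (h t)) none t t<N)

  mismatches+2∑gh≡∑g+∑h : ∀ {g h} → Binary g → Binary h →
                         mismatches g h + 2 * ∑[ t < N ] (g t * h t) ≡ ∑< N g + ∑< N h
  mismatches+2∑gh≡∑g+∑h {g} {h} gb hb = begin
    mismatches g h + 2 * ∑[ t < N ] (g t * h t)          ≡⟨ cong (mismatches g h +_) (∑-distribˡ-* N 2 _) ⟨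
    mismatches g h + ∑[ t < N ] (2 * (g t * h t))        ≡⟨ ∑-distrib-+ N _ _ ⟨
    ∑[ t < N ] (differ (g t) (h t) + 2 * (g t * h t))    ≡⟨ ∑-cong N (λ t _ → differ+2*≡+ (gb t) (hb t)) ⟩
    ∑[ t < N ] (g t + h t)                               ≡⟨ ∑-distrib-+ N g h ⟩
    ∑< N g + ∑< N h                                      ∎
    where open ≡-Reasoning

  mismatches-shift-even : ∀ {g} → Periodic g → Binary g → ∀ s → Σ ℕ λ a → mismatches g (shift s g) ≡ 2 * a
  mismatches-shift-even {g} gp gb s = ∑< N g ∸ shared , (begin
    mismatches g (shift s g)                          ≡⟨ m+n∸n≡m _ (2 * shared) ⟨
    mismatches g (shift s g) + 2 * shared ∸ 2 * shared
      ≡⟨ cong (_∸ 2 * shared) (mismatches+2∑gh≡∑g+∑h gb (gb ∘ (_+ s))) ⟩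
    ∑< N g + ∑< N (shift s g) ∸ 2 * shared          ≡⟨ cong (λ x → ∑< N g + x ∸ 2 * shared) (trans (∑-shift gp s) (sym (+-identityʳ _))) ⟩
    2 * ∑< N g ∸ 2 * shared                          ≡⟨ *-distribˡ-∸ 2 (∑< N g) shared ⟨
    2 * (∑< N g ∸ shared)                            ∎)
    where
    open ≡-Reasoning
    shared = ∑[ t < N ] (g t * g (t + s))

  shift-invariant⇒constant : ∀ {g} s → gcd N s ≡ 1 → Periodic g → (∀ t → g (t + s) ≡ g t) →
                             ∀ t → g t ≡ g 0
  shift-invariant⇒constant {g} s coprime gp invariant t with coprime⇒bézout coprime
  ... | Bézout.+- x y 1+ys≡xN = begin
    g t                   ≡⟨ shift-invariant-iterate s invariant (t * y) t ⟨
    g (t + t * y * s)     ≡⟨ cong g (1+ab≡cd⇒t+tab≡tcd t 1+ys≡xN) ⟩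
    g (t * x * N)         ≡⟨ gp _ 0 ([m+kn]%n≡m%n 0 (t * x) N) ⟩
    g 0                   ∎
    where open ≡-Reasoning
  ... | Bézout.-+ x y 1+xN≡ys = sym (begin
    g 0                   ≡⟨ shift-invariant-iterate s invariant (t * y) 0 ⟨
    g (t * y * s)         ≡⟨ cong g (1+ab≡cd⇒t+tab≡tcd t 1+xN≡ys) ⟨
    g (t + t * x * N)     ≡⟨ gp _ t ([m+kn]%n≡m%n t (t * x) N) ⟩
    g t                   ∎)
    where open ≡-Reasoning

  mismatches-shift≡0⇒constant : ∀ {g} s → gcd N s ≡ 1 → Periodic g → mismatches g (shift s g) ≡ 0 →
                                ∀ t → g t ≡ g 0
  mismatches-shift≡0⇒constant s coprime gp none = shift-invariant⇒constant s coprime gp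
    (λ t → sym (mismatches≡0⇒≡ gp (shift-periodic gp s) none t))

  constant⇒mismatches≡N : ∀ {g h} → Binary g → Binary h → (∀ t → g t ≡ g 0) →
                          ∑< N g + ∑< N h ≡ N → mismatches g h ≡ N
  constant⇒mismatches≡N {g} {h} gb hb constant count = begin
    mismatches g h                                 ≡⟨ +-identityʳ _ ⟨
    mismatches g h + 2 * 0                         ≡⟨ cong (λ x → mismatches g h + 2 * x) ∑gh≡0 ⟨
    mismatches g h + 2 * ∑[ t < N ] (g t * h t)    ≡⟨ mismatches+2∑gh≡∑g+∑h gb hb ⟩
    ∑< N g + ∑< N h                                ≡⟨ count ⟩
    N                                              ∎
    where
    open ≡-Reasoning
    ∑g≡N*g0 : ∑< N g ≡ N * g 0
    ∑g≡N*g0 = trans (∑-cong N (λ t _ → constant t)) (∑-const N (g 0))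
    bitTimes∑h≡0 : ∀ c → c ≤ 1 → N * c + ∑< N h ≡ N → c * ∑< N h ≡ 0
    bitTimes∑h≡0 zero          _        _  = refl
    bitTimes∑h≡0 (suc zero)    _        eq = trans (+-identityʳ _) (+-cancelˡ-≡ N _ _
      (trans (cong (_+ ∑< N h) (sym (*-identityʳ N))) (trans eq (sym (+-identityʳ N)))))
    bitTimes∑h≡0 (suc (suc _)) (s≤s ()) _
    ∑gh≡0 : ∑[ t < N ] (g t * h t) ≡ 0
    ∑gh≡0 = begin
      ∑[ t < N ] (g t * h t)     ≡⟨ ∑-cong N (λ t _ → cong (_* h t) (constant t)) ⟩
      ∑[ t < N ] (g 0 * h t)     ≡⟨ ∑-distribˡ-* N (g 0) h ⟩
      g 0 * ∑< N h               ≡⟨ bitTimes∑h≡0 (g 0) (gb 0) (trans (cong (_+ ∑< N h) (sym ∑g≡N*g0)) count) ⟩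
      0                          ∎

  module Runs {g : ℕ → ℕ} (gp : Periodic g) (gb : Binary g) where

    changes : ℕ → ℕ
    changes t = differ (g t) (g (t + 1))

    window : ℕ → ℕ → ℕ
    window i m = ∑[ t < m ] changes (i + t)

    changes-periodic : ∀ t → changes (t + N) ≡ changes t
    changes-periodic t = cong₂ differ (periodic-+N gp t) (periodic-+N (shift-periodic gp 1) t)

    window-N : ∀ i → window i N ≡ mismatches g (shift 1 g)
    window-N = ∑-rotate N changes changes-periodic

    window-suc : ∀ i m → window i (suc m) ≡ window i m + changes (i + m)
    window-suc i m = ∑-last m (λ t → changes (i + t))

    window≡0⇒constant : ∀ i m → window i m ≡ 0 → ∀ t → t ≤ m → g (i + t) ≡ g i
    window≡0⇒constant i m none zero    _   = cong g (+-identityʳ i)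
    window≡0⇒constant i m none (suc t) t<m = begin
      g (i + suc t)    ≡⟨ cong g (m+n+1≡m+[1+n] i t) ⟨
      g (i + t + 1)    ≡⟨ differ≡0⇒≡ _ _ (∑≡0⇒≡0 m (λ t → changes (i + t)) none t t<m) ⟨
      g (i + t)        ≡⟨ window≡0⇒constant i m none t (<⇒≤ t<m) ⟩
      g i              ∎
      where open ≡-Reasoning

    differ≡window : ∀ i m → window i m ≤ 1 → differ (g i) (g (i + m)) ≡ window i m
    differ≡window i zero    _   = trans (cong (differ (g i) ∘ g) (+-identityʳ i)) (differ-refl (g i))
    differ≡window i (suc m) w≤1 = begin
      differ (g i) (g (i + suc m))                  ≡⟨ cong (differ (g i) ∘ g) (m+n+1≡m+[1+n] i m) ⟨
      differ (g i) (g (i + m + 1))                  ≡⟨ differ-trans (gb i) (gb (i + m)) (gb (i + m + 1)) bound ⟩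
      differ (g i) (g (i + m)) + changes (i + m)    ≡⟨ cong (_+ changes (i + m)) ih ⟩
      window i m + changes (i + m)                  ≡⟨ window-suc i m ⟨
      window i (suc m)                              ∎
      where
      open ≡-Reasoning
      ih : differ (g i) (g (i + m)) ≡ window i m
      ih = differ≡window i m (≤-trans (m≤m+n _ _) (≤-trans (≤-reflexive (sym (window-suc i m))) w≤1))
      bound : differ (g i) (g (i + m)) + changes (i + m) ≤ 1
      bound = ≤-trans (≤-reflexive (trans (cong (_+ changes (i + m)) ih) (sym (window-suc i m)))) w≤1

    ∑-window : ∀ m → ∑[ i < N ] window i m ≡ m * mismatches g (shift 1 g)
    ∑-window m = begin
      ∑[ i < N ] ∑[ t < m ] changes (i + t)     ≡⟨ ∑-comm N m (λ i t → changes (i + t)) ⟩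
      ∑[ t < m ] ∑[ i < N ] changes (i + t)     ≡⟨ ∑-cong m (λ t _ → ∑-cong N (λ i _ → cong changes (+-comm i t))) ⟩
      ∑[ t < m ] ∑[ i < N ] changes (t + i)     ≡⟨ ∑-cong m (λ t _ → ∑-rotate N changes changes-periodic t) ⟩
      ∑[ t < m ] mismatches g (shift 1 g)       ≡⟨ ∑-const m _ ⟩
      m * mismatches g (shift 1 g)              ∎
      where open ≡-Reasoning

    balanced-run-bound : ∑< N g + ∑< N g ≡ N → ∀ j L → L ≤ N →
                         (∀ t → t < L → g (j + t) ≡ g j) → L + L ≤ N
    balanced-run-bound balanced j L L≤N run = ≤-trans (+-mono-≤ L≤∑g L≤∑g) (≤-reflexive balanced)
      where
      M = N ∸ L
      rest = ∑[ t < M ] g (j + (L + t))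
      rest≤M : rest ≤ M
      rest≤M = ≤-trans (∑-mono-≤ M (λ t → gb (j + (L + t)))) (≤-reflexive (trans (∑-const M 1) (*-identityʳ M)))
      ∑g-split : ∑< N g ≡ L * g j + rest
      ∑g-split = begin
        ∑< N g                                              ≡⟨ ∑-rotate N g (periodic-+N gp) j ⟨
        ∑[ t < N ] g (j + t)                                ≡⟨ cong (λ n → ∑[ t < n ] g (j + t)) (m+[n∸m]≡n L≤N) ⟨
        ∑[ t < L + M ] g (j + t)                            ≡⟨ ∑-split L M (λ t → g (j + t)) ⟩
        ∑[ t < L ] g (j + t) + rest                         ≡⟨ cong (_+ rest) (trans (∑-cong L run) (∑-const L (g j))) ⟩
        L * g j + rest                                      ∎
        where open ≡-Reasoning
      L≤∑g : L ≤ ∑< N g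
      L≤∑g with n≤1⇒n≡0∨n≡1 (gb j)
      ... | inj₂ gj≡1 = begin
        L                 ≡⟨ trans (cong (L *_) gj≡1) (*-identityʳ L) ⟨
        L * g j           ≤⟨ m≤m+n _ rest ⟩
        L * g j + rest    ≡⟨ ∑g-split ⟨
        ∑< N g            ∎
        where open ≤-Reasoning
      ... | inj₁ gj≡0 = +-cancelʳ-≤ M L (∑< N g) (begin
        L + M             ≡⟨ m+[n∸m]≡n L≤N ⟩
        N                 ≡⟨ balanced ⟨
        ∑< N g + ∑< N g   ≤⟨ +-monoʳ-≤ (∑< N g) ∑g≤M ⟩
        ∑< N g + M        ∎)
        where
        open ≤-Reasoning
        ∑g≤M : ∑< N g ≤ M
        ∑g≤M = ≤-trans (≤-reflexive (trans ∑g-split (cong (λ c → L * c + rest) gj≡0)))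
                       (≤-trans (≤-reflexive (cong (_+ rest) (*-zeroʳ L))) rest≤M)

    -- A window of length k containing both changes would leave a constant run of length N ∸ k > N/2.
    window≤1 : ∀ {k} → 2 * k < N → ∑< N g + ∑< N g ≡ N → mismatches g (shift 1 g) ≡ 2 → ∀ i → window i k ≤ 1
    window≤1 {k} 2k<N balanced two i with window i k ≤? 1
    ... | yes w≤1 = w≤1
    ... | no  w≰1 = contradiction (balanced-run-bound balanced (i + k) M (m∸n≤m N k) run) (<⇒≱ (n<[n∸k]+[n∸k] k 2k<N))
      where
      M = N ∸ k
      k≤N : k ≤ N
      k≤N = ≤-trans (m≤m+n k (k + 0)) (<⇒≤ 2k<N)
      split : window i N ≡ window i k + window (i + k) M
      split = begin
        window i N                                 ≡⟨ cong (window i) (m+[n∸m]≡n k≤N) ⟨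
        window i (k + M)                           ≡⟨ ∑-split k M (λ t → changes (i + t)) ⟩
        window i k + ∑[ t < M ] changes (i + (k + t)) ≡⟨ cong (window i k +_) (∑-cong M (λ t _ → cong changes (+-assoc i k t))) ⟨
        window i k + window (i + k) M              ∎
        where open ≡-Reasoning
      rest≡0 : window (i + k) M ≡ 0
      rest≡0 = n≤0⇒n≡0 (+-cancelˡ-≤ 2 _ 0 (begin
        2 + window (i + k) M            ≤⟨ +-monoˡ-≤ _ (≰⇒> w≰1) ⟩
        window i k + window (i + k) M   ≡⟨ split ⟨
        window i N                      ≡⟨ trans (window-N i) two ⟩
        2                               ∎))
        where open ≤-Reasoning
      run : ∀ t → t < M → g (i + k + t) ≡ g (i + k)
      run t t<M = window≡0⇒constant (i + k) M rest≡0 t (<⇒≤ t<M)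

    twoChanges⇒mismatches-shift : ∀ {k} → 2 * k < N → ∑< N g + ∑< N g ≡ N →
                                  mismatches g (shift 1 g) ≡ 2 → mismatches g (shift k g) ≡ 2 * k
    twoChanges⇒mismatches-shift {k} 2k<N balanced two = begin
      mismatches g (shift k g)         ≡⟨ ∑-cong N (λ i _ → differ≡window i k (window≤1 {k} 2k<N balanced two i)) ⟩
      ∑[ i < N ] window i k            ≡⟨ ∑-window k ⟩
      k * mismatches g (shift 1 g)     ≡⟨ cong (k *_) two ⟩
      k * 2                            ≡⟨ *-comm k 2 ⟩
      2 * k                            ∎
      where open ≡-Reasoning

  fiveMismatches : ∀ {k α β} → 5 ≤ N → 2 ≤ k → 2 * k < N → gcd N k ≡ 1 →
                   Periodic α → Periodic β → Binary α → Binary β → ∑< N α + ∑< N β ≡ N →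
                   5 ≤ mismatches α (shift 1 α) + (mismatches α β + mismatches β (shift k β))
  fiveMismatches {k} {α} {β} 5≤N 2≤k 2k<N coprime αp βp αb βb count
    with mismatches-shift-even αp αb 1 | mismatches-shift-even βp βb k
  ... | a , A≡2a | b , B≡2b =
    subst (5 ≤_) (sym (cong₂ (λ A B → A + (R + B)) A≡2a B≡2b))
          (five≤2a+[r+2b] a R b 5≤N outerConstant innerConstant noSpokes)
    where
    R = mismatches α β
    outerConstant : a ≡ 0 → R ≡ N
    outerConstant a≡0 = constant⇒mismatches≡N αb βb
      (mismatches-shift≡0⇒constant 1 (∣1⇒≡1 (gcd[m,n]∣n N 1)) αp (trans A≡2a (cong (2 *_) a≡0))) count
    innerConstant : b ≡ 0 → R ≡ N
    innerConstant b≡0 = trans (mismatches-comm α β) (constant⇒mismatches≡N βb αb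
      (mismatches-shift≡0⇒constant k coprime βp (trans B≡2b (cong (2 *_) b≡0))) (trans (+-comm (∑< N β) (∑< N α)) count))
    noSpokes : R ≡ 0 → a ≡ 1 → b ≡ 1 → ⊥
    noSpokes R≡0 a≡1 b≡1 = <⇒≢ (*-monoʳ-< 2 2≤k) (sym 2k≡2)
      where
      α≡β : ∀ t → α t ≡ β t
      α≡β = mismatches≡0⇒≡ αp βp R≡0
      balanced : ∑< N α + ∑< N α ≡ N
      balanced = trans (cong (∑< N α +_) (∑-cong N (λ t _ → α≡β t))) count
      2k≡2 : 2 * k ≡ 2
      2k≡2 = begin
        2 * k                       ≡⟨ Runs.twoChanges⇒mismatches-shift αp αb 2k<N balanced (trans A≡2a (cong (2 *_) a≡1)) ⟨
        mismatches α (shift k α)    ≡⟨ ∑-cong N (λ t _ → cong₂ differ (α≡β t) (α≡β (t + k))) ⟩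
        mismatches β (shift k β)    ≡⟨ trans B≡2b (cong (2 *_) b≡1) ⟩
        2                           ∎
        where open ≡-Reasoning

-- Odd edges of labellings of P(n,k)

oddEdges-∷ : ∀ {V : Set} {n} (f : V → Fin n) x y es →
             oddEdges f ((x , y) ∷ es) ≡ differ (label f x % 2) (label f y % 2) + oddEdges f es
oddEdges-∷ f x y es with label f x % 2 ≡ᵇ label f y % 2
... | true  = refl
... | false = refl

oddEdges-++ : ∀ {V : Set} {n} (f : V → Fin n) xs ys → oddEdges f (xs ++ ys) ≡ oddEdges f xs + oddEdges f ys
oddEdges-++ f []              ys = refl
oddEdges-++ f ((x , y) ∷ xs) ys = begin
  oddEdges f ((x , y) ∷ xs ++ ys)               ≡⟨ oddEdges-∷ f x y (xs ++ ys) ⟩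
  d + oddEdges f (xs ++ ys)                     ≡⟨ cong (d +_) (oddEdges-++ f xs ys) ⟩
  d + (oddEdges f xs + oddEdges f ys)           ≡⟨ +-assoc d (oddEdges f xs) (oddEdges f ys) ⟨
  d + oddEdges f xs + oddEdges f ys             ≡⟨ cong (_+ oddEdges f ys) (oddEdges-∷ f x y xs) ⟨
  oddEdges f ((x , y) ∷ xs) + oddEdges f ys     ∎
  where
  open ≡-Reasoning
  d = differ (label f x % 2) (label f y % 2)

oddEdges-concatMap : ∀ {V : Set} {n} (f : V → Fin n) (edgesAt : ℕ → List (V × V)) (g : ℕ → ℕ) len →
                     oddEdges f (concatMap edgesAt (applyUpTo g len)) ≡ ∑[ i < len ] oddEdges f (edgesAt (g i))
oddEdges-concatMap f edgesAt g zero      = refl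
oddEdges-concatMap f edgesAt g (suc len) =
  trans (oddEdges-++ f (edgesAt (g 0)) (concatMap edgesAt (applyUpTo (g ∘ suc) len)))
        (cong (oddEdges f (edgesAt (g 0)) +_) (oddEdges-concatMap f edgesAt (g ∘ suc) len))

sum-toℕ : ∀ n (g : ℕ → ℕ) → sum (λ (i : Fin n) → g (toℕ i)) ≡ ∑< n g
sum-toℕ zero    g = refl
sum-toℕ (suc n) g = cong (g 0 +_) (sum-toℕ n (g ∘ suc))

[r+2q]%2≡r : ∀ {r} q → r < 2 → (r + 2 * q) % 2 ≡ r
[r+2q]%2≡r {r} q r<2 = begin
  (r + 2 * q) % 2    ≡⟨ cong (λ x → (r + x) % 2) (*-comm 2 q) ⟩
  (r + q * 2) % 2    ≡⟨ [m+kn]%n≡m%n r q 2 ⟩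
  r % 2              ≡⟨ m<n⇒m%n≡m r<2 ⟩
  r                  ∎
  where open ≡-Reasoning

[r+2q]/2≡q : ∀ {r} q → r < 2 → (r + 2 * q) / 2 ≡ q
[r+2q]/2≡q {r} q r<2 = begin
  (r + 2 * q) / 2          ≡⟨ cong (λ x → (r + x) / 2) (*-comm 2 q) ⟩
  (r + q * 2) / 2          ≡⟨ +-distrib-/ r (q * 2) no-carry ⟩
  r / 2 + q * 2 / 2        ≡⟨ cong₂ _+_ (m<n⇒m/n≡0 r<2) (m*n/n≡m q 2) ⟩
  q                        ∎
  where
  open ≡-Reasoning
  no-carry : r % 2 + q * 2 % 2 < 2
  no-carry = subst (_< 2) (sym (trans (cong₂ _+_ (m<n⇒m%n≡m r<2) (m*n%n≡0 q 2)) (+-identityʳ r))) r<2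

[1+2q]%2≡1 : ∀ q → suc (2 * q) % 2 ≡ 1
[1+2q]%2≡1 q = [r+2q]%2≡r q (s<s z<s)

[2+2q]%2≡0 : ∀ q → suc (suc (2 * q)) % 2 ≡ 0
[2+2q]%2≡0 q = trans (cong (_% 2) (sym (*-suc 2 q))) ([r+2q]%2≡r (suc q) z<s)

∑-odd-labels : ∀ n → ∑[ t < 2 * n ] (suc t % 2) ≡ n
∑-odd-labels n = begin
  ∑[ t < 2 * n ] (suc t % 2)                              ≡⟨ ∑-pairs n (λ t → suc t % 2) ⟩
  ∑[ i < n ] (suc (2 * i) % 2 + suc (suc (2 * i)) % 2)    ≡⟨ ∑-cong n (λ i _ → cong₂ _+_ ([1+2q]%2≡1 i) ([2+2q]%2≡0 i)) ⟩
  ∑[ i < n ] 1                                            ≡⟨ ∑-const n 1 ⟩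
  n * 1                                                   ≡⟨ *-identityʳ n ⟩
  n                                                       ∎
  where open ≡-Reasoning

%≡⇒mod≡ : ∀ x y {n} .{{_ : NonZero n}} → x % n ≡ y % n → x mod n ≡ y mod n
%≡⇒mod≡ x y {n} eq = toℕ-injective (trans (toℕ-fromℕ< (m%n<n x n)) (trans eq (sym (toℕ-fromℕ< (m%n<n y n)))))

toℕ-mod : ∀ {q n} .{{_ : NonZero n}} → q < n → toℕ (q mod n) ≡ q
toℕ-mod {q} {n} q<n = trans (toℕ-fromℕ< (m%n<n q n)) (m<n⇒m%n≡m q<n)

module Labelling (m : ℕ) where

  N : ℕ
  N = suc m

  open BinaryCyclic N

  module _ (f : PVertex N → Fin (2 * N)) where

    outerParity innerParity : ℕ → ℕ
    outerParity t = label f (inj₁ (t mod N)) % 2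
    innerParity t = label f (inj₂ (t mod N)) % 2

    -- The edges contributed by index i in PEdges, restated here because that list is local to PEdges.
    vertexEdges : ℕ → ℕ → List (PVertex N × PVertex N)
    vertexEdges k i = (inj₁ (i mod N) , inj₁ ((i + 1) mod N))
                    ∷ (inj₁ (i mod N) , inj₂ (i mod N))
                    ∷ (inj₂ (i mod N) , inj₂ ((i + k) mod N))
                    ∷ []

    oddEdges-vertexEdges : ∀ k i → oddEdges f (vertexEdges k i) ≡
      differ (outerParity i) (outerParity (i + 1)) +
      (differ (outerParity i) (innerParity i) + differ (innerParity i) (innerParity (i + k)))
    oddEdges-vertexEdges k i = begin
      oddEdges f ((uᵢ , uᵢ₊₁) ∷ (uᵢ , vᵢ) ∷ (vᵢ , vᵢ₊ₖ) ∷ [])   ≡⟨ oddEdges-∷ f uᵢ uᵢ₊₁ ((uᵢ , vᵢ) ∷ (vᵢ , vᵢ₊ₖ) ∷ []) ⟩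
      outer + oddEdges f ((uᵢ , vᵢ) ∷ (vᵢ , vᵢ₊ₖ) ∷ [])         ≡⟨ cong (outer +_) (oddEdges-∷ f uᵢ vᵢ ((vᵢ , vᵢ₊ₖ) ∷ [])) ⟩
      outer + (spoke + oddEdges f ((vᵢ , vᵢ₊ₖ) ∷ []))          ≡⟨ cong (λ x → outer + (spoke + x)) (oddEdges-∷ f vᵢ vᵢ₊ₖ []) ⟩
      outer + (spoke + (inner + 0))                             ≡⟨ cong (λ x → outer + (spoke + x)) (+-identityʳ inner) ⟩
      outer + (spoke + inner)                                   ∎
      where
      open ≡-Reasoning
      uᵢ uᵢ₊₁ vᵢ vᵢ₊ₖ : PVertex N
      uᵢ   = inj₁ (i mod N)
      uᵢ₊₁ = inj₁ ((i + 1) mod N)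
      vᵢ   = inj₂ (i mod N)
      vᵢ₊ₖ = inj₂ ((i + k) mod N)
      outer spoke inner : ℕ
      outer = differ (outerParity i) (outerParity (i + 1))
      spoke = differ (outerParity i) (innerParity i)
      inner = differ (innerParity i) (innerParity (i + k))

    oddEdges-PEdges : ∀ k → oddEdges f (PEdges N k) ≡
      ∑[ i < N ] (differ (outerParity i) (outerParity (i + 1)) +
                  (differ (outerParity i) (innerParity i) + differ (innerParity i) (innerParity (i + k))))
    oddEdges-PEdges k = trans (oddEdges-concatMap f (vertexEdges k) (λ i → i) N) (∑-cong N (λ i _ → oddEdges-vertexEdges k i))

    oddEdges≡mismatches : ∀ k → oddEdges f (PEdges N k) ≡
      mismatches outerParity (shift 1 outerParity) +
      (mismatches outerParity innerParity + mismatches innerParity (shift k innerParity))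
    oddEdges≡mismatches k = trans (oddEdges-PEdges k)
      (trans (∑-distrib-+ N (λ i → differ (outerParity i) (outerParity (i + 1)))
                            (λ i → differ (outerParity i) (innerParity i) + differ (innerParity i) (innerParity (i + k))))
             (cong (mismatches outerParity (shift 1 outerParity) +_)
                   (∑-distrib-+ N (λ i → differ (outerParity i) (innerParity i))
                                  (λ i → differ (innerParity i) (innerParity (i + k))))))

    outerParity-periodic : Periodic outerParity
    outerParity-periodic x y eq = cong (λ i → label f (inj₁ i) % 2) (%≡⇒mod≡ x y eq)

    innerParity-periodic : Periodic innerParity
    innerParity-periodic x y eq = cong (λ i → label f (inj₂ i) % 2) (%≡⇒mod≡ x y eq)

    outerParity-binary : Binary outerParity
    outerParity-binary t = s≤s⁻¹ (m%n<n (label f (inj₁ (t mod N))) 2)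

    innerParity-binary : Binary innerParity
    innerParity-binary t = s≤s⁻¹ (m%n<n (label f (inj₂ (t mod N))) 2)

  side : ℕ → Fin N → PVertex N
  side zero    = inj₁
  side (suc _) = inj₂

  vertexAt : ℕ → PVertex N
  vertexAt t = side (t % 2) ((t / 2) mod N)

  position : PVertex N → ℕ
  position (inj₁ i) = 2 * toℕ i
  position (inj₂ i) = suc (2 * toℕ i)

  vertexAt-side : ∀ {r} q → r < 2 → vertexAt (r + 2 * q) ≡ side r (q mod N)
  vertexAt-side q r<2 = cong₂ side ([r+2q]%2≡r q r<2) (cong (_mod N) ([r+2q]/2≡q q r<2))

  position-side : ∀ {r q} → r < 2 → q < N → position (side r (q mod N)) ≡ r + 2 * q
  position-side {zero}        _        q<N = cong (2 *_) (toℕ-mod q<N)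
  position-side {suc zero}    _        q<N = cong (suc ∘ (2 *_)) (toℕ-mod q<N)
  position-side {suc (suc _)} (s≤s (s≤s ())) _

  vertexAt-position : ∀ v → vertexAt (position v) ≡ v
  vertexAt-position (inj₁ i) = trans (vertexAt-side (toℕ i) z<s) (cong inj₁ (toℕ-injective (toℕ-mod (toℕ<n i))))
  vertexAt-position (inj₂ i) = trans (vertexAt-side (toℕ i) (s<s z<s)) (cong inj₂ (toℕ-injective (toℕ-mod (toℕ<n i))))

  position-vertexAt : ∀ t → t < 2 * N → position (vertexAt t) ≡ t
  position-vertexAt t t<2N = begin
    position (vertexAt t)        ≡⟨ position-side (m%n<n t 2) (m<n*o⇒m/o<n (subst (t <_) (*-comm 2 N) t<2N)) ⟩
    t % 2 + 2 * (t / 2)          ≡⟨ cong (t % 2 +_) (*-comm 2 (t / 2)) ⟩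
    t % 2 + t / 2 * 2            ≡⟨ m≡m%n+[m/n]*n t 2 ⟨
    t                            ∎
    where open ≡-Reasoning

  position<2N : ∀ v → position v < 2 * N
  position<2N (inj₁ i) = *-monoʳ-< 2 (toℕ<n i)
  position<2N (inj₂ i) = ≤-trans (≤-reflexive (sym (*-suc 2 (toℕ i)))) (*-monoʳ-≤ 2 (toℕ<n i))

  interleavedLabelling : PVertex N → Fin (2 * N)
  interleavedLabelling v = fromℕ< (position<2N v)

  interleavedLabelling↔ : PVertex N ↔ Fin (2 * N)
  interleavedLabelling↔ = mk↔ₛ′ interleavedLabelling (vertexAt ∘ toℕ)
    (λ y → toℕ-injective (trans (toℕ-fromℕ< (position<2N (vertexAt (toℕ y)))) (position-vertexAt (toℕ y) (toℕ<n y))))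
    (λ v → trans (cong vertexAt (toℕ-fromℕ< (position<2N v))) (vertexAt-position v))

  ∑-parities≡N : ∀ f → IsLabelling N f → ∑< N (outerParity f) + ∑< N (innerParity f) ≡ N
  ∑-parities≡N f bijective = begin
    ∑< N (outerParity f) + ∑< N (innerParity f)       ≡⟨ ∑-distrib-+ N (outerParity f) (innerParity f) ⟨
    ∑[ i < N ] (outerParity f i + innerParity f i)    ≡⟨ ∑-cong N (λ i _ → cong₂ _+_ (cong labelParityAt (vertexAt-side i z<s))
                                                                                     (cong labelParityAt (vertexAt-side i (s<s z<s)))) ⟨
    ∑[ i < N ] (ψ (2 * i) + ψ (suc (2 * i)))          ≡⟨ ∑-pairs N ψ ⟨
    ∑< (2 * N) ψ                                      ≡⟨ sum-toℕ (2 * N) ψ ⟨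
    sum (λ (y : Fin (2 * N)) → ψ (toℕ y))             ≡⟨ sum-permute labelParity π ⟨
    sum labelParity                                   ≡⟨ sum-toℕ (2 * N) (λ t → suc t % 2) ⟩
    ∑[ t < 2 * N ] (suc t % 2)                        ≡⟨ ∑-odd-labels N ⟩
    N                                                 ∎
    where
    open ≡-Reasoning
    labelParityAt : PVertex N → ℕ
    labelParityAt v = label f v % 2
    ψ : ℕ → ℕ
    ψ = labelParityAt ∘ vertexAt
    labelParity : Fin (2 * N) → ℕ
    labelParity y = suc (toℕ y) % 2
    π : Permutation (2 * N) (2 * N)
    π = ↔-trans (↔-sym interleavedLabelling↔) (⤖⇒↔ (mk⤖ bijective))

  interleavedLabelling-bijective : IsLabelling N interleavedLabelling
  interleavedLabelling-bijective = Bijection.bijective (↔⇒⤖ interleavedLabelling↔)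

  oddEdges-interleavedLabelling : ∀ k → oddEdges interleavedLabelling (PEdges N k) ≡ N
  oddEdges-interleavedLabelling k = begin
    oddEdges interleavedLabelling (PEdges N k)   ≡⟨ oddEdges-PEdges interleavedLabelling k ⟩
    ∑[ i < N ] (differ (α i) (α (i + 1)) + (differ (α i) (β i) + differ (β i) (β (i + k))))
      ≡⟨ ∑-cong N (λ i _ → cong₂ _+_ (cong₂ differ (α≡1 i) (α≡1 (i + 1)))
                                     (cong₂ _+_ (cong₂ differ (α≡1 i) (β≡0 i)) (cong₂ differ (β≡0 i) (β≡0 (i + k))))) ⟩
    ∑[ i < N ] 1                 ≡⟨ ∑-const N 1 ⟩
    N * 1                        ≡⟨ *-identityʳ N ⟩
    N                            ∎
    where
    open ≡-Reasoning
    α β : ℕ → ℕ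
    α = outerParity interleavedLabelling
    β = innerParity interleavedLabelling
    α≡1 : ∀ t → α t ≡ 1
    α≡1 t = trans (cong (λ x → suc x % 2) (toℕ-fromℕ< (position<2N (inj₁ (t mod N))))) ([1+2q]%2≡1 (toℕ (t mod N)))
    β≡0 : ∀ t → β t ≡ 0
    β≡0 t = trans (cong (λ x → suc x % 2) (toℕ-fromℕ< (position<2N (inj₂ (t mod N))))) ([2+2q]%2≡0 (toℕ (t mod N)))

theorem4p3 : (n k : ℕ) → 5 ≤ n → 2 ≤ k → 2 * k < n → gcd n k ≡ 1 →
    ((f : PVertex n → Fin (2 * n)) → IsLabelling n f → 5 ≤ oddEdges f (PEdges n k))
    × Σ (PVertex n → Fin (2 * n)) (λ f → IsLabelling n f × (oddEdges f (PEdges n k) ≤ n))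
theorem4p3 (suc m) k 5≤n 2≤k 2k<n coprime =
  lowerBound , interleavedLabelling , interleavedLabelling-bijective , ≤-reflexive (oddEdges-interleavedLabelling k)
  where
  open Labelling m
  open BinaryCyclic N
  lowerBound : ∀ f → IsLabelling N f → 5 ≤ oddEdges f (PEdges N k)
  lowerBound f bijective = subst (5 ≤_) (sym (oddEdges≡mismatches f k))
    (fiveMismatches 5≤n 2≤k 2k<n coprime
      (outerParity-periodic f) (innerParity-periodic f) (outerParity-binary f) (innerParity-binary f)
      (∑-parities≡N f bijective))
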